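{- Let $x\in\mathbb N$ with $x>0$. Then for every ordinal $\alpha<\varepsilon_0$, $|\alpha|\le G_\alpha(x)$.
   Context: Ordinals below $\varepsilon_0$ are denoted by terms in Cantor normal form $\omega^{\alpha_1}+\cdots+\omega^{\alpha_m}$ with $\alpha_1\ge\cdots\ge\alpha_m$ (exponents again such terms). Term size: $|0|=0$, $|\omega^\alpha|=1+|\alpha|$, $|\alpha+\alpha'|=|\alpha|+|\alpha'|$. Limit ordinals have fundamental sequences $(\gamma+\omega^{\beta+1})(x)=\gamma+\omega^\beta\cdot(x+1)$, $(\gamma+\omega^{\lambda'})(x)=\gamma+\omega^{\lambda'(x)}$ for $\lambda'$ limit. Slow-growing hierarchy: $G_0(x)=0$, $G_{\alpha+1}(x)=1+G_\alpha(x)$, $G_\lambda(x)=G_{\lambda(x)}(x)$. -}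

module Defs where

open import Data.Nat using (ℕ; zero; suc; _+_)
open import Relation.Binary.PropositionalEquality using (_≡_)
open import Data.Product using (_×_)
open import Data.Sum using (_⊎_)

-- Cantor normal form terms below ε₀:  ω^ a + b  represents ω^a + b,
-- so ω^α₁ + ⋯ + ω^αₘ is  ω^ α₁ + (⋯ (ω^ αₘ + 𝟎)).
infixr 5 ω^_+_
data Ord : Set where
  𝟎    : Ord
  ω^_+_ : Ord → Ord → Ord

infix 4 _<ₒ_ _≤ₒ_
data _<ₒ_ : Ord → Ord → Set where
  <-zero : ∀ {a b} → 𝟎 <ₒ ω^ a + b
  <-exp  : ∀ {a b c d} → a <ₒ c → ω^ a + b <ₒ ω^ c + d
  <-tail : ∀ {a b d} → b <ₒ d → ω^ a + b <ₒ ω^ a + d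

_≤ₒ_ : Ord → Ord → Set
a ≤ₒ b = a <ₒ b ⊎ a ≡ b

data NF : Ord → Set where
  nf-zero : NF 𝟎
  nf-one  : ∀ {a} → NF a → NF (ω^ a + 𝟎)
  nf-cons : ∀ {a c d} → NF a → NF (ω^ c + d) → c ≤ₒ a → NF (ω^ a + ω^ c + d)

size : Ord → ℕ
size 𝟎 = 0
size (ω^ a + b) = suc (size a) + size b

ωmul : Ord → ℕ → Ord
ωmul β zero = 𝟎
ωmul β (suc k) = ω^ β + ωmul β k

data Kind : Set where
  kzero : Kind
  ksuc  : Ord → Kind
  klim  : (ℕ → Ord) → Kind

kind : Ord → Kind
kind 𝟎 = kzero
kind (ω^ a + ω^ c + d) with kind (ω^ c + d)
... | kzero  = kzero   -- impossible
... | ksuc β = ksuc (ω^ a + β)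
... | klim f = klim (λ x → ω^ a + f x)
kind (ω^ a + 𝟎) with kind a
... | kzero  = ksuc 𝟎                             -- ω^0 = 0 + 1
... | ksuc β = klim (λ x → ωmul β (suc x))         -- ω^(β+1)(x) = ω^β·(x+1)
... | klim f = klim (λ x → ω^ f x + 𝟎)             -- ω^λ(x) = ω^(λ(x))

-- graph of the slow-growing hierarchy: GrG α x n  means  G_α(x) = n
data GrG : Ord → ℕ → ℕ → Set where
  g-zero : ∀ {α x} → kind α ≡ kzero → GrG α x 0
  g-suc  : ∀ {α β x n} → kind α ≡ ksuc β → GrG β x n → GrG α x (suc n)
  g-lim  : ∀ {α f x n} → kind α ≡ klim f → GrG (f x) x n → GrG α x n

-- G is additive over concatenation of terms, and G_{ω^α}(x) = (x+1)^{G_α(x)}: the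
-- fundamental sequence of ω^{β+1} at x is x+1 copies of ω^β. Hence, by induction on the
-- term, each summand ω^α contributes (x+1)^{G_α(x)} ≥ 1 + G_α(x) ≥ 1 + |α| once x ≥ 1.
module Submission where

open import Defs
open import Data.Nat using (ℕ; zero; suc; _+_; _*_; _^_; _<_; _≤_; z≤n; s≤s)
open import Data.Nat.Properties
  using (+-mono-≤; ≤-trans; n<1+n; +-suc; +-identityʳ; ^-monoʳ-<)
open import Data.Product using (Σ; _×_; _,_)
open import Relation.Binary.PropositionalEquality
  using (_≡_; _≢_; refl; sym; trans; cong; subst; module ≡-Reasoning)

-- Concatenation of terms; it is ordinal addition only when no absorption occurs,
-- but G is additive on it regardless.
infixr 5 _⊕_
_⊕_ : Ord → Ord → Ord
𝟎 ⊕ β = β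
(ω^ a + α) ⊕ β = ω^ a + (α ⊕ β)

⊕-identityʳ : ∀ α → α ⊕ 𝟎 ≡ α
⊕-identityʳ 𝟎 = refl
⊕-identityʳ (ω^ a + α) = cong (ω^ a +_) (⊕-identityʳ α)

prefixKind : Ord → Kind → Kind
prefixKind α kzero = kzero
prefixKind α (ksuc β) = ksuc (α ⊕ β)
prefixKind α (klim f) = klim (λ x → α ⊕ f x)

prefixKind-𝟎 : ∀ k → prefixKind 𝟎 k ≡ k
prefixKind-𝟎 kzero = refl
prefixKind-𝟎 (ksuc β) = refl
prefixKind-𝟎 (klim f) = refl

prefixKind-ω^ : ∀ a α k →
  prefixKind (ω^ a + 𝟎) (prefixKind α k) ≡ prefixKind (ω^ a + α) k
prefixKind-ω^ a α kzero = refl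
prefixKind-ω^ a α (ksuc β) = refl
prefixKind-ω^ a α (klim f) = refl

prefixKind≡kzero : ∀ α k → prefixKind α k ≡ kzero → k ≡ kzero
prefixKind≡kzero α kzero _ = refl

kind-ω^-cons : ∀ a c d →
  kind (ω^ a + ω^ c + d) ≡ prefixKind (ω^ a + 𝟎) (kind (ω^ c + d))
kind-ω^-cons a c d with kind (ω^ c + d)
... | kzero = refl
... | ksuc β = refl
... | klim f = refl

kind-⊕ : ∀ α c d → kind (α ⊕ ω^ c + d) ≡ prefixKind α (kind (ω^ c + d))
kind-⊕ 𝟎 c d = sym (prefixKind-𝟎 _)
kind-⊕ (ω^ a + 𝟎) c d = kind-ω^-cons a c d
kind-⊕ (ω^ a + ω^ e + g) c d = begin
  kind (ω^ a + ω^ e + (g ⊕ ω^ c + d))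
    ≡⟨ kind-ω^-cons a e (g ⊕ ω^ c + d) ⟩
  prefixKind (ω^ a + 𝟎) (kind (ω^ e + (g ⊕ ω^ c + d)))
    ≡⟨ cong (prefixKind (ω^ a + 𝟎)) (kind-⊕ (ω^ e + g) c d) ⟩
  prefixKind (ω^ a + 𝟎) (prefixKind (ω^ e + g) (kind (ω^ c + d)))
    ≡⟨ prefixKind-ω^ a (ω^ e + g) (kind (ω^ c + d)) ⟩
  prefixKind (ω^ a + ω^ e + g) (kind (ω^ c + d)) ∎
  where open ≡-Reasoning

powerKind : Kind → Kind
powerKind kzero = ksuc 𝟎
powerKind (ksuc β) = klim (λ x → ωmul β (suc x))
powerKind (klim f) = klim (λ x → ω^ f x + 𝟎)

kind-ω^ : ∀ a → kind (ω^ a + 𝟎) ≡ powerKind (kind a)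
kind-ω^ a with kind a
... | kzero = refl
... | ksuc β = refl
... | klim f = refl

powerKind≢kzero : ∀ k → powerKind k ≢ kzero
powerKind≢kzero kzero ()
powerKind≢kzero (ksuc β) ()
powerKind≢kzero (klim f) ()

kind-ω^+≢kzero : ∀ a b → kind (ω^ a + b) ≢ kzero
kind-ω^+≢kzero a 𝟎 eq = powerKind≢kzero (kind a) (trans (sym (kind-ω^ a)) eq)
kind-ω^+≢kzero a (ω^ c + d) eq =
  kind-ω^+≢kzero c d (prefixKind≡kzero _ _ (trans (sym (kind-ω^-cons a c d)) eq))

kind≡kzero⇒≡𝟎 : ∀ α → kind α ≡ kzero → α ≡ 𝟎
kind≡kzero⇒≡𝟎 𝟎 _ = refl
kind≡kzero⇒≡𝟎 (ω^ a + b) eq with () ← kind-ω^+≢kzero a b eq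

G-⊕ : ∀ {x α β m n} → GrG α x m → GrG β x n → GrG (α ⊕ β) x (m + n)
G-⊕ {α = α} {β} {m} Gα (g-zero eq)
  rewrite kind≡kzero⇒≡𝟎 β eq | ⊕-identityʳ α | +-identityʳ m = Gα
G-⊕ {β = 𝟎} Gα (g-suc () _)
G-⊕ {α = α} {β = ω^ c + d} {m} {suc n} Gα (g-suc eq Gβ) =
  subst (GrG _ _) (sym (+-suc m n))
    (g-suc (trans (kind-⊕ α c d) (cong (prefixKind α) eq)) (G-⊕ Gα Gβ))
G-⊕ {β = 𝟎} Gα (g-lim () _)
G-⊕ {α = α} {β = ω^ c + d} Gα (g-lim eq Gβ) =
  g-lim (trans (kind-⊕ α c d) (cong (prefixKind α) eq)) (G-⊕ Gα Gβ)

G-ωmul : ∀ {x β p} → GrG (ω^ β + 𝟎) x p → ∀ k → GrG (ωmul β k) x (k * p)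
G-ωmul G zero = g-zero refl
G-ωmul G (suc k) = G-⊕ G (G-ωmul G k)

G-ω^ : ∀ {x a m} → GrG a x m → GrG (ω^ a + 𝟎) x (suc x ^ m)
G-ω^ {a = a} (g-zero eq) =
  g-suc (trans (kind-ω^ a) (cong powerKind eq)) (g-zero refl)
G-ω^ {x} {a} (g-suc eq G) =
  g-lim (trans (kind-ω^ a) (cong powerKind eq)) (G-ωmul (G-ω^ G) (suc x))
G-ω^ {a = a} (g-lim eq G) =
  g-lim (trans (kind-ω^ a) (cong powerKind eq)) (G-ω^ G)

n<m^n : ∀ m → 1 < m → ∀ n → n < m ^ n
n<m^n m 1<m zero = s≤s z≤n
n<m^n m 1<m (suc n) = ≤-trans (s≤s (n<m^n m 1<m n)) (^-monoʳ-< m 1<m (n<1+n n))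

size≤G : ∀ x → 0 < x → ∀ α → Σ ℕ (λ n → GrG α x n × size α ≤ n)
size≤G x x>0 𝟎 = 0 , g-zero refl , z≤n
size≤G x x>0 (ω^ a + b) with size≤G x x>0 a | size≤G x x>0 b
... | m , Ga , |a|≤m | k , Gb , |b|≤k =
  suc x ^ m + k ,
  G-⊕ (G-ω^ Ga) Gb ,
  +-mono-≤ (≤-trans (s≤s |a|≤m) (n<m^n (suc x) (s≤s x>0) m)) |b|≤k

lemmaA8 : (x : ℕ) → 0 < x → (α : Ord) → NF α →
    Σ ℕ (λ n → GrG α x n × size α ≤ n)
lemmaA8 x x>0 α _ = size≤G x x>0 α
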